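{- Let $a,s,t$ be integers such that $t$ is even, $2\le s<t$, $0\le a\le\min\{\lfloor s/3\rfloor,\,t-s\}$, and $a\equiv s\pmod 2$. Let $S=\{\pm\frac{s+1}{2},\pm\frac{s+3}{2},\ldots,\pm(\frac t2-1)\}\cup\{\frac t2\}$ if $s$ is odd, and $S=\{\pm\frac s2,\pm(\frac s2+1),\ldots,\pm(\frac t2-1)\}$ if $s$ is even. Then $\overrightarrow{\mathrm{Circ}}(t;S)$ admits an $S$-orthogonal $(\vec P_1^{\langle a\rangle},\vec C_2^{\langle (t-s-a)/2\rangle})$-subdigraph, i.e., a subdigraph that is a vertex-disjoint union of $a$ directed paths with one arc each and $(t-s-a)/2$ directed 2-cycles, containing exactly one arc of each difference in $S$.
   Context: For $S\subseteq\mathbb{Z}_t\setminus\{0\}$, the directed circulant $\overrightarrow{\mathrm{Circ}}(t;S)$ has vertex set $\{u_i:i\in\mathbb{Z}_t\}$ and arcs $(u_i,u_{i+d})$ for $i\in\mathbb{Z}_t$, $d\in S$; the arc $(u_i,u_{i+d})$ has difference $d$. A subdigraph is $S$-orthogonal if it contains exactly one arc of each difference in $S$. A directed 2-cycle is a pair of opposite arcs between two vertices. -}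

module Defs where

open import Data.Nat using (ℕ; zero; suc; _+_; _∸_; _≤_; _<_)
open import Data.Nat.DivMod using (_%_; _/_)
open import Data.Product using (_×_; _,_; ∃-syntax)
open import Data.Sum using (_⊎_)
open import Data.List using (List; []; _∷_; _++_; map; concatMap; length)
open import Data.List.Relation.Unary.All using (All)
open import Data.List.Relation.Unary.Unique.Propositional using (Unique)
open import Data.List.Membership.Propositional using (_∈_)
open import Relation.Binary.PropositionalEquality using (_≡_)

-- Vertex u_i of Circ(t;S) is represented by the natural number i with i < t
-- (elements of ℤ_t are represented by their residues 0,…,t-1).
-- An arc (u_i , u_j) is represented by the pair (i , j).
Arc : Set
Arc = ℕ × ℕ

diff : ℕ → Arc → ℕ
diff zero    _       = 0
diff (suc n) (i , j) = (j + (suc n ∸ i)) % suc n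

IsOdd IsEven : ℕ → Set
IsOdd  n = n % 2 ≡ 1
IsEven n = n % 2 ≡ 0

PMRange : ℕ → ℕ → ℕ → Set
PMRange lo t d = ∃[ k ] (lo ≤ k × k ≤ t / 2 ∸ 1 × (d ≡ k ⊎ d ≡ t ∸ k))

InS : (s t d : ℕ) → Set
InS s t d =
  (IsOdd s × (PMRange ((s + 1) / 2) t d ⊎ d ≡ t / 2))
  ⊎ (IsEven s × PMRange (s / 2) t d)

-- Arcs of the subdigraph consisting of the 1-arc paths (x→y) in `paths`
-- and the directed 2-cycles x⇄y in `cycles`.
arcsOf : List Arc → List (ℕ × ℕ) → List Arc
arcsOf paths cycles =
  paths ++ concatMap (λ { (x , y) → (x , y) ∷ (y , x) ∷ [] }) cycles

vertsOf : List Arc → List (ℕ × ℕ) → List ℕ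
vertsOf paths cycles = concatMap (λ { (x , y) → x ∷ y ∷ [] }) (paths ++ cycles)

IsOrthogonalPC : (s t a c : ℕ) → List Arc → List (ℕ × ℕ) → Set
IsOrthogonalPC s t a c paths cycles =
  length paths ≡ a
  × length cycles ≡ c
  × All (λ v → v < t) (vertsOf paths cycles)
  -- the components are pairwise vertex-disjoint (and each has distinct ends)
  × Unique (vertsOf paths cycles)
  × All (λ e → InS s t (diff t e)) (arcsOf paths cycles)
  × Unique (map (diff t) (arcsOf paths cycles))
  × (∀ d → d < t → InS s t d → d ∈ map (diff t) (arcsOf paths cycles))

-- Write t = 2n and list the vertices of ℤ_t in the interleaved order w₀ = u₀, w₁ = u_n,
-- w₂ = u₁, w₃ = u_{n+1}, …  Since w_{2r+j} = w_j + r, the arc w_j → w_{t−2−j} has difference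
-- n − 1 − j and its reverse has difference n + 1 + j.  For j < D, the number of pairs ±k in S,
-- these arcs are vertex-disjoint, with endpoints at positions j < D and t − 2 − j > t − 2 − D;
-- the first b of them are taken as paths and the remaining c = D − b as directed 2-cycles.
-- The b differences n + 1 + i (i < b) that the paths miss are supplied by the paths
-- u_{p+i} → u_{n+p+2i+1} with p = ⌈D/2⌉, and for odd s the difference n by u_{p+2b} → u_{n+p+2b}.
-- Their endpoints sit at positions in the middle band [D, t − 2 − D], which is wide enough for
-- them because a ≤ s/3.
module Submission where

open import Defs
open import Data.Bool using (Bool; true; false)
open import Data.Empty using (⊥; ⊥-elim)
open import Data.Nat using (ℕ; zero; suc; _+_; _*_; _∸_; _≤_; _<_; z≤n; s≤s)
open import Data.Nat.DivMod
  using (_%_; _/_; /-congˡ; %-congˡ; m*n/n≡m; m*n%n≡0; [m+kn]%n≡m%n; [m+n]%n≡m%n; m<n⇒m%n≡m;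
         m/n*n≤m)
open import Data.Nat.Properties
open import Data.Nat.Tactic.RingSolver using (solve-∀)
open import Data.Product using (_×_; _,_; ∃-syntax; proj₁; proj₂; swap)
import Data.Product as Product
open import Data.Sum using (_⊎_; inj₁; inj₂)
open import Data.List using (List; []; _∷_; _++_; map; upTo; applyUpTo; length)
open import Data.List.Properties
  using (map-++; map-id; map-upTo; map-∘; map-cong-local; ++-assoc; ++-identityʳ;
         length-++; length-map; length-upTo)
open import Data.List.Relation.Unary.All using (All; []; _∷_)
import Data.List.Relation.Unary.All as All
import Data.List.Relation.Unary.All.Properties as All
open import Data.List.Relation.Unary.Any using (here; there)
open import Data.List.Relation.Unary.Unique.Propositional using (Unique; []; _∷_)
import Data.List.Relation.Unary.Unique.Propositional.Properties as Unique
open import Data.List.Membership.Propositional using (_∈_)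
open import Data.List.Membership.Propositional.Properties
  using (∈-map⁻; ∈-map⁺; ∈-upTo⁻; ∈-upTo⁺; ∈-++⁻; ∈-++⁺ˡ; ∈-++⁺ʳ)
open import Data.List.Relation.Binary.Permutation.Propositional
  using (_↭_; prep; ↭-sym; ↭⇒↭ₛ; module PermutationReasoning)
open import Data.List.Relation.Binary.Permutation.Propositional.Properties
  using (All-resp-↭; ∈-resp-↭; shift; shifts; ++⁺ˡ; ++-comm)
import Data.List.Relation.Binary.Permutation.Setoid.Properties as PermutationSetoid
open import Function using (_∘_)
open import Function.Bundles using (_⇔_; mk⇔; Equivalence)
open import Relation.Binary.PropositionalEquality
open import Relation.Nullary using (¬_)

InjectiveOn : (ℕ → ℕ) → List ℕ → Set
InjectiveOn f xs = ∀ {x y} → x ∈ xs → y ∈ xs → f x ≡ f y → x ≡ y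

map⁺-injectiveOn : ∀ {f : ℕ → ℕ} {xs} → InjectiveOn f xs → Unique xs → Unique (map f xs)
map⁺-injectiveOn {xs = []}             inj []         = []
map⁺-injectiveOn {f = f} {xs = x ∷ xs} inj (x∉ ∷ u) =
  All.tabulate fresh ∷ map⁺-injectiveOn (λ x∈ y∈ → inj (there x∈) (there y∈)) u
  where
  fresh : ∀ {y} → y ∈ map f xs → f x ≢ y
  fresh y∈ eq with ∈-map⁻ f y∈
  ... | z , z∈ , refl = All.lookup x∉ z∈ (inj (here refl) (there z∈) eq)

Unique-resp-↭ : ∀ {xs ys : List ℕ} → xs ↭ ys → Unique xs → Unique ys
Unique-resp-↭ p = PermutationSetoid.Unique-resp-↭ (setoid ℕ) (↭⇒↭ₛ p)

++⁺-separated : ∀ {P Q : ℕ → Set} {xs ys} → Unique xs → Unique ys → All P xs → All Q ys →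
                (∀ {v} → P v → Q v → ⊥) → Unique (xs ++ ys)
++⁺-separated uxs uys Pxs Qys P⇒¬Q =
  Unique.++⁺ uxs uys λ (v∈xs , v∈ys) → P⇒¬Q (All.lookup Pxs v∈xs) (All.lookup Qys v∈ys)

++-interchange : ∀ {A : Set} (a b c d e : List A) →
                 (a ++ (b ++ c)) ++ (d ++ e) ↭ ((a ++ d) ++ (b ++ e)) ++ c
++-interchange a b c d e = begin
  (a ++ (b ++ c)) ++ (d ++ e)   ≡⟨ ++-assoc a (b ++ c) (d ++ e) ⟩
  a ++ ((b ++ c) ++ (d ++ e))   ↭⟨ ++⁺ˡ a (shifts (b ++ c) d) ⟩
  a ++ (d ++ ((b ++ c) ++ e))   ≡⟨ ++-assoc a d _ ⟨
  (a ++ d) ++ ((b ++ c) ++ e)   ≡⟨ cong ((a ++ d) ++_) (++-assoc b c e) ⟩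
  (a ++ d) ++ (b ++ (c ++ e))   ↭⟨ ++⁺ˡ (a ++ d) (++⁺ˡ b (++-comm c e)) ⟩
  (a ++ d) ++ (b ++ (e ++ c))   ≡⟨ cong ((a ++ d) ++_) (++-assoc b e c) ⟨
  (a ++ d) ++ ((b ++ e) ++ c)   ≡⟨ ++-assoc (a ++ d) (b ++ e) c ⟨
  ((a ++ d) ++ (b ++ e)) ++ c   ∎
  where open PermutationReasoning

upTo-++ : ∀ b c → upTo b ++ map (b +_) (upTo c) ≡ upTo (b + c)
upTo-++ zero    c = map-id (upTo c)
upTo-++ (suc b) c = cong (0 ∷_) (begin
  applyUpTo suc b ++ map (suc b +_) (upTo c)        ≡⟨ cong (_++ map (suc b +_) (upTo c)) (map-upTo suc b) ⟨
  map suc (upTo b) ++ map (suc b +_) (upTo c)       ≡⟨ cong (map suc (upTo b) ++_) (map-∘ (upTo c)) ⟩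
  map suc (upTo b) ++ map suc (map (b +_) (upTo c)) ≡⟨ map-++ suc (upTo b) _ ⟨
  map suc (upTo b ++ map (b +_) (upTo c))           ≡⟨ cong (map suc) (upTo-++ b c) ⟩
  map suc (upTo (b + c))                            ≡⟨ map-upTo suc (b + c) ⟩
  applyUpTo suc (b + c)                             ∎)
  where open ≡-Reasoning

-- Defined through vertsOf so that vertsOf ps cs is definitionally ends (ps ++ cs).
ends : List Arc → List ℕ
ends arcs = vertsOf [] arcs

ends-++ : ∀ xs ys → ends (xs ++ ys) ≡ ends xs ++ ends ys
ends-++ []       ys = refl
ends-++ (e ∷ xs) ys = cong (λ l → proj₁ e ∷ proj₂ e ∷ l) (ends-++ xs ys)

ends-relabel : ∀ (f : ℕ → ℕ) es → ends (map (Product.map f f) es) ≡ map f (ends es)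
ends-relabel f []       = refl
ends-relabel f (e ∷ es) = cong (λ l → f (proj₁ e) ∷ f (proj₂ e) ∷ l) (ends-relabel f es)

ends-map-↭ : ∀ (f g : ℕ → ℕ) is → ends (map (λ i → f i , g i) is) ↭ map f is ++ map g is
ends-map-↭ f g []       = _↭_.refl
ends-map-↭ f g (i ∷ is) = prep (f i) (begin
  g i ∷ ends (map (λ i → f i , g i) is) <⟨ ends-map-↭ f g is ⟩
  g i ∷ map f is ++ map g is            ↭⟨ shift (g i) (map f is) (map g is) ⟨
  map f is ++ g i ∷ map g is            ∎)
  where open PermutationReasoning

∈-ends-map⁻ : ∀ {f g : ℕ → ℕ} {v} is → v ∈ ends (map (λ i → f i , g i) is) →
              ∃[ i ] i ∈ is × (v ≡ f i ⊎ v ≡ g i)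
∈-ends-map⁻ {f} {g} is v∈ with ∈-++⁻ (map f is) (∈-resp-↭ (ends-map-↭ f g is) v∈)
... | inj₁ v∈f = let i , i∈ , eq = ∈-map⁻ f v∈f in i , i∈ , inj₁ eq
... | inj₂ v∈g = let i , i∈ , eq = ∈-map⁻ g v∈g in i , i∈ , inj₂ eq

ends-map-All : ∀ {P : ℕ → Set} {f g : ℕ → ℕ} is → All P (map f is) → All P (map g is) →
               All P (ends (map (λ i → f i , g i) is))
ends-map-All {f = f} {g} is Pf Pg = All-resp-↭ (↭-sym (ends-map-↭ f g is)) (All.++⁺ Pf Pg)

ends-map-unique : ∀ {f g : ℕ → ℕ} {is} → Unique is → InjectiveOn f is → InjectiveOn g is →
                  (∀ {i j} → i ∈ is → j ∈ is → f i ≢ g j) →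
                  Unique (ends (map (λ i → f i , g i) is))
ends-map-unique {f} {g} {is} u f-inj g-inj f≢g = Unique-resp-↭ (↭-sym (ends-map-↭ f g is))
  (Unique.++⁺ (map⁺-injectiveOn f-inj u) (map⁺-injectiveOn g-inj u) disjoint)
  where
  disjoint : ∀ {v} → ¬ (v ∈ map f is × v ∈ map g is)
  disjoint (v∈f , v∈g) with ∈-map⁻ f v∈f | ∈-map⁻ g v∈g
  ... | i , i∈ , refl | j , j∈ , eq = f≢g i∈ j∈ eq

map-diff-bothWays : ∀ t cs →
                    map (diff t) (arcsOf [] cs) ≡ ends (map (λ e → diff t e , diff t (swap e)) cs)
map-diff-bothWays t []       = refl
map-diff-bothWays t (e ∷ cs) = cong (λ l → diff t e ∷ diff t (swap e) ∷ l) (map-diff-bothWays t cs)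

isOrthogonalPC : ∀ {s t a c} paths cycles (ds : List ℕ) →
  length paths ≡ a → length cycles ≡ c →
  All (_< t) (vertsOf paths cycles) → Unique (vertsOf paths cycles) →
  map (diff t) (arcsOf paths cycles) ↭ ds → Unique ds → (∀ {d} → InS s t d ⇔ d ∈ ds) →
  IsOrthogonalPC s t a c paths cycles
isOrthogonalPC paths cycles ds #paths #cycles vertices-< vertices-unique diffs↭ds ds-unique S⇔ds =
    #paths , #cycles , vertices-< , vertices-unique
  , All.map⁻ (All-resp-↭ (↭-sym diffs↭ds) (All.tabulate (Equivalence.from S⇔ds)))
  , Unique-resp-↭ (↭-sym diffs↭ds) ds-unique
  , λ d _ d∈S → ∈-resp-↭ (↭-sym diffs↭ds) (Equivalence.to S⇔ds d∈S)

data Parity : ℕ → Set where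
  even : ∀ j → Parity (2 * j)
  odd  : ∀ j → Parity (suc (2 * j))

parity : ∀ k → Parity k
parity zero    = even zero
parity (suc k) with parity k
... | even j = odd j
... | odd j  = subst Parity (*-suc 2 j) (even (suc j))

<-halve : ∀ {i n} → 2 * i < 2 * n → i < n
<-halve lt = ≰⇒> λ n≤i → <⇒≱ lt (*-monoʳ-≤ 2 n≤i)

2*x/2≡x : ∀ x → 2 * x / 2 ≡ x
2*x/2≡x x = trans (/-congˡ {o = 2} (*-comm 2 x)) (m*n/n≡m x 2)

[2+2*x]/2≡1+x : ∀ x → (suc (2 * x) + 1) / 2 ≡ suc x
[2+2*x]/2≡1+x x = trans (/-congˡ {o = 2} (identity x)) (2*x/2≡x (suc x))
  where identity : ∀ x → suc (2 * x) + 1 ≡ 2 * suc x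
        identity = solve-∀

2*x%2≡0 : ∀ x → 2 * x % 2 ≡ 0
2*x%2≡0 x = trans (%-congˡ {o = 2} (*-comm 2 x)) (m*n%n≡0 x 2)

[1+2*x]%2≡1 : ∀ x → suc (2 * x) % 2 ≡ 1
[1+2*x]%2≡1 x = trans (%-congˡ {o = 2} (cong suc (*-comm 2 x))) ([m+kn]%n≡m%n 1 x 2)

diff-forward : ∀ t {x r} → x + r < t → diff t (x , x + r) ≡ r
diff-forward (suc T) {x} {r} lt = begin
  (x + r + (suc T ∸ x)) % suc T   ≡⟨ cong (_% suc T) (+-comm (x + r) _) ⟩
  ((suc T ∸ x) + (x + r)) % suc T ≡⟨ cong (_% suc T) (+-assoc (suc T ∸ x) x r) ⟨
  ((suc T ∸ x) + x + r) % suc T   ≡⟨ cong (λ y → (y + r) % suc T) (m∸n+n≡m x≤t) ⟩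
  (suc T + r) % suc T             ≡⟨ cong (_% suc T) (+-comm (suc T) r) ⟩
  (r + suc T) % suc T             ≡⟨ [m+n]%n≡m%n r (suc T) ⟩
  r % suc T                       ≡⟨ m<n⇒m%n≡m (≤-<-trans (m≤n+m r x) lt) ⟩
  r                               ∎
  where
  open ≡-Reasoning
  x≤t : x ≤ suc T
  x≤t = ≤-trans (m≤m+n x r) (<⇒≤ lt)

diff-backward : ∀ t {x r} → 0 < r → x + r < t → diff t (x + r , x) ≡ t ∸ r
diff-backward (suc T) {x} {r} 0<r lt = begin
  (x + (suc T ∸ (x + r))) % suc T ≡⟨ cong (_% suc T) x+[t∸[x+r]]≡t∸r ⟩
  (suc T ∸ r) % suc T             ≡⟨ m<n⇒m%n≡m (∸-monoʳ-< 0<r (≤-trans (m≤n+m r x) (<⇒≤ lt))) ⟩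
  suc T ∸ r                       ∎
  where
  open ≡-Reasoning
  x+[t∸[x+r]]≡t∸r : x + (suc T ∸ (x + r)) ≡ suc T ∸ r
  x+[t∸[x+r]]≡t∸r = begin
    x + (suc T ∸ (x + r))   ≡⟨ +-∸-assoc x (<⇒≤ lt) ⟨
    x + suc T ∸ (x + r)     ≡⟨ ∸-+-assoc (x + suc T) x r ⟨
    x + suc T ∸ x ∸ r       ≡⟨ cong (_∸ r) (m+n∸m≡n x (suc T)) ⟩
    suc T ∸ r               ∎

interleave : ℕ → ℕ → ℕ
interleave n zero          = zero
interleave n (suc zero)    = n
interleave n (suc (suc k)) = suc (interleave n k)

interleave-shift : ∀ n r k → interleave n (2 * r + k) ≡ interleave n k + r
interleave-shift n zero    k = sym (+-identityʳ _)
interleave-shift n (suc r) k = begin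
  interleave n (2 * suc r + k)    ≡⟨ cong (λ x → interleave n (x + k)) (*-suc 2 r) ⟩
  suc (interleave n (2 * r + k))  ≡⟨ cong suc (interleave-shift n r k) ⟩
  suc (interleave n k + r)        ≡⟨ +-suc _ r ⟨
  interleave n k + suc r          ∎
  where open ≡-Reasoning

interleave-even : ∀ n j → interleave n (2 * j) ≡ j
interleave-even n j = trans (cong (interleave n) (sym (+-identityʳ (2 * j)))) (interleave-shift n j 0)

interleave-odd : ∀ n j → interleave n (suc (2 * j)) ≡ n + j
interleave-odd n j = trans (cong (interleave n) (+-comm 1 (2 * j))) (interleave-shift n j 1)

interleave-< : ∀ n {k} → k < 2 * n → interleave n k < 2 * n
interleave-< n {k} k< with parity k
... | even j = subst (_< 2 * n) (sym (interleave-even n j)) (≤-<-trans (m≤n*m j 2) k<)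
... | odd j  = subst (_< 2 * n) (sym (interleave-odd n j))
                 (+-monoʳ-< n (<-≤-trans (<-halve {j} {n} (<-trans (n<1+n _) k<)) (m≤m+n n 0)))

interleave-injective : ∀ n {k l} → k < 2 * n → l < 2 * n → interleave n k ≡ interleave n l → k ≡ l
interleave-injective n {k} {l} k< l< eq with parity k | parity l
... | even i | even j = cong (2 *_) (subst₂ _≡_ (interleave-even n i) (interleave-even n j) eq)
... | odd i  | odd j  = cong (λ x → suc (2 * x))
        (+-cancelˡ-≡ n _ _ (subst₂ _≡_ (interleave-odd n i) (interleave-odd n j) eq))
... | even i | odd j  = ⊥-elim (<⇒≱ (<-halve {i} {n} k<) (subst (n ≤_) (sym i≡n+j) (m≤m+n n j)))
  where i≡n+j = subst₂ _≡_ (interleave-even n i) (interleave-odd n j) eq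
... | odd i  | even j = ⊥-elim (<⇒≱ (<-halve {j} {n} l<) (subst (n ≤_) n+i≡j (m≤m+n n i)))
  where n+i≡j = subst₂ _≡_ (interleave-odd n i) (interleave-even n j) eq

-- With n = m + D + 1, the set S is {±k : m < k < n}, together with n = t/2 when centred.
-- Its pairs ±k are indexed by j = n − 1 − k < D = b + c.
module Construction (m b c p : ℕ) (D≤2p : b + c ≤ 2 * p) (2p≤1+D : 2 * p ≤ suc (b + c))
                    (room : 2 * b ≤ m) (centred : Bool) (centre-room : centred ≡ true → 2 * b < m)
                    where

  D n t : ℕ
  D = b + c
  n = suc (m + D)
  t = 2 * n

  w : ℕ → ℕ
  w = interleave n

  relabel : ℕ × ℕ → Arc
  relabel = Product.map w w

  low high : ℕ → ℕ
  low j  = m + D ∸ j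
  high j = n + suc j

  low+j : ∀ {j} → j < D → low j + j ≡ m + D
  low+j j<D = m∸n+n≡m (≤-trans (<⇒≤ j<D) (m≤n+m D m))

  m<low : ∀ {j} → j < D → m < low j
  m<low {j} j<D = m+n≤o⇒m≤o∸n (suc m) (subst (_≤ m + D) (+-suc m j) (+-monoʳ-≤ m j<D))

  low-injective : ∀ {i j} → i < D → j < D → low i ≡ low j → i ≡ j
  low-injective {i} {j} i<D j<D eq =
    +-cancelˡ-≡ (low i) i j (trans (low+j i<D) (sym (trans (cong (_+ j) eq) (low+j j<D))))

  t≡high+low : ∀ {j} → j < D → t ≡ high j + low j
  t≡high+low {j} j<D = begin
    2 * n                 ≡⟨ identity n ⟩
    n + suc (m + D)       ≡⟨ cong (λ x → n + suc x) (low+j j<D) ⟨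
    n + suc (low j + j)   ≡⟨ cong (λ x → n + suc x) (+-comm (low j) j) ⟩
    n + (suc j + low j)   ≡⟨ +-assoc n (suc j) (low j) ⟨
    high j + low j        ∎
    where
    open ≡-Reasoning
    identity : ∀ n → 2 * n ≡ n + n
    identity = solve-∀

  t∸low : ∀ {j} → j < D → t ∸ low j ≡ high j
  t∸low {j} j<D = trans (cong (_∸ low j) (t≡high+low j<D)) (m+n∸n≡m (high j) (low j))

  D≤2m+D : D ≤ 2 * m + D
  D≤2m+D = m≤n+m D (2 * m)

  2m+D<t : 2 * m + D < t
  2m+D<t = begin-strict
    2 * m + D       ≤⟨ +-monoʳ-≤ (2 * m) (m≤n*m D 2) ⟩
    2 * m + 2 * D   ≡⟨ *-distribˡ-+ 2 m D ⟨
    2 * (m + D)     <⟨ *-monoʳ-< 2 (n<1+n (m + D)) ⟩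
    t               ∎
    where open ≤-Reasoning

  -- Arcs are built on labels, i.e. positions in the interleaved order; relabel turns them into
  -- arcs of the circulant.
  highLabel : ℕ → ℕ
  highLabel j = 2 * low j + j

  pairLabel : ℕ → ℕ × ℕ
  pairLabel j = j , highLabel j

  crossLabel : ℕ → ℕ × ℕ
  crossLabel i = 2 * (p + i) , suc (2 * (p + suc (2 * i)))

  centreLabel : ℕ × ℕ
  centreLabel = 2 * (p + 2 * b) , suc (2 * (p + 2 * b))

  highLabel≡ : ∀ {j} → j < D → highLabel j ≡ low j + (m + D)
  highLabel≡ {j} j<D = trans (identity (low j) j) (cong (low j +_) (low+j j<D))
    where identity : ∀ x j → 2 * x + j ≡ x + (x + j)
          identity = solve-∀

  highLabel-< : ∀ {j} → j < D → highLabel j < t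
  highLabel-< {j} j<D = begin-strict
    highLabel j         ≡⟨ highLabel≡ j<D ⟩
    low j + (m + D)     ≤⟨ +-monoˡ-≤ (m + D) (m∸n≤m (m + D) j) ⟩
    (m + D) + (m + D)   ≡⟨ cong ((m + D) +_) (+-identityʳ (m + D)) ⟨
    2 * (m + D)         <⟨ *-monoʳ-< 2 (n<1+n (m + D)) ⟩
    t                   ∎
    where open ≤-Reasoning

  2m+D<highLabel : ∀ {j} → j < D → 2 * m + D < highLabel j
  2m+D<highLabel {j} j<D = begin-strict
    2 * m + D         ≡⟨ identity m D ⟩
    m + (m + D)       <⟨ +-monoˡ-< (m + D) (m<low j<D) ⟩
    low j + (m + D)   ≡⟨ highLabel≡ j<D ⟨
    highLabel j       ∎
    where
    open ≤-Reasoning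
    identity : ∀ m D → 2 * m + D ≡ m + (m + D)
    identity = solve-∀

  highLabel-injective : ∀ {i j} → i < D → j < D → highLabel i ≡ highLabel j → i ≡ j
  highLabel-injective i<D j<D eq = low-injective i<D j<D
    (+-cancelʳ-≡ (m + D) _ _ (trans (sym (highLabel≡ i<D)) (trans eq (highLabel≡ j<D))))

  Mid : ℕ → Set
  Mid ℓ = D ≤ ℓ × ℓ ≤ 2 * m + D

  D≤2[p+x] : ∀ x → D ≤ 2 * (p + x)
  D≤2[p+x] x = ≤-trans D≤2p (*-monoʳ-≤ 2 (m≤m+n p x))

  1+2[p+x]≤2m+D : ∀ {x} → x < m → suc (2 * (p + x)) ≤ 2 * m + D
  1+2[p+x]≤2m+D {x} x<m = begin
    suc (2 * (p + x))     ≡⟨ cong suc (*-distribˡ-+ 2 p x) ⟩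
    suc (2 * p + 2 * x)   ≤⟨ s≤s (+-monoˡ-≤ (2 * x) 2p≤1+D) ⟩
    suc (suc D + 2 * x)   ≡⟨ identity D x ⟩
    2 * suc x + D         ≤⟨ +-monoˡ-≤ D (*-monoʳ-≤ 2 x<m) ⟩
    2 * m + D             ∎
    where
    open ≤-Reasoning
    identity : ∀ D x → suc (suc D + 2 * x) ≡ 2 * suc x + D
    identity = solve-∀

  mid-even : ∀ {x} → x < m → Mid (2 * (p + x))
  mid-even x<m = D≤2[p+x] _ , ≤-trans (n≤1+n _) (1+2[p+x]≤2m+D x<m)

  mid-odd : ∀ {x} → x < m → Mid (suc (2 * (p + x)))
  mid-odd x<m = m≤n⇒m≤1+n (D≤2[p+x] _) , 1+2[p+x]≤2m+D x<m

  mid-< : ∀ {ℓ} → Mid ℓ → ℓ < t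
  mid-< (_ , ℓ≤) = ≤-<-trans ℓ≤ 2m+D<t

  1+2i<m : ∀ {i} → i < b → suc (2 * i) < m
  1+2i<m {i} i<b = ≤-trans (≤-reflexive (sym (*-suc 2 i))) (≤-trans (*-monoʳ-≤ 2 i<b) room)

  diff-relabel : ∀ {x y r} → w y ≡ w x + r → y < t → diff t (relabel (x , y)) ≡ r
  diff-relabel {x} {y} {r} wy y<t = subst (λ v → diff t (w x , v) ≡ r) (sym wy)
    (diff-forward t (subst (_< t) wy (interleave-< n y<t)))

  diff-relabel-swap : ∀ {x y r} → 0 < r → w y ≡ w x + r → y < t →
                      diff t (swap (relabel (x , y))) ≡ t ∸ r
  diff-relabel-swap {x} {y} {r} 0<r wy y<t = subst (λ v → diff t (v , w x) ≡ t ∸ r) (sym wy)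
    (diff-backward t 0<r (subst (_< t) wy (interleave-< n y<t)))

  diff-pair : ∀ {j} → j < D → diff t (relabel (pairLabel j)) ≡ low j
  diff-pair {j} j<D = diff-relabel (interleave-shift n (low j) j) (highLabel-< j<D)

  diff-pair-swap : ∀ {j} → j < D → diff t (swap (relabel (pairLabel j))) ≡ high j
  diff-pair-swap {j} j<D = trans
    (diff-relabel-swap (≤-<-trans z≤n (m<low j<D)) (interleave-shift n (low j) j) (highLabel-< j<D))
    (t∸low j<D)

  diff-cross : ∀ {i} → i < b → diff t (relabel (crossLabel i)) ≡ high i
  diff-cross {i} i<b = diff-relabel w-cross (mid-< (mid-odd (1+2i<m i<b)))
    where
    identity : ∀ n p i → n + (p + suc (2 * i)) ≡ p + i + (n + suc i)
    identity = solve-∀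
    w-cross : w (suc (2 * (p + suc (2 * i)))) ≡ w (2 * (p + i)) + high i
    w-cross = begin
      w (suc (2 * (p + suc (2 * i))))   ≡⟨ interleave-odd n _ ⟩
      n + (p + suc (2 * i))             ≡⟨ identity n p i ⟩
      p + i + high i                    ≡⟨ cong (_+ high i) (interleave-even n (p + i)) ⟨
      w (2 * (p + i)) + high i          ∎
      where open ≡-Reasoning

  diff-centre : 2 * b < m → diff t (relabel centreLabel) ≡ n
  diff-centre 2b<m = diff-relabel w-centre (mid-< (mid-odd 2b<m))
    where
    w-centre : w (suc (2 * (p + 2 * b))) ≡ w (2 * (p + 2 * b)) + n
    w-centre = begin
      w (suc (2 * (p + 2 * b)))   ≡⟨ interleave-odd n _ ⟩
      n + (p + 2 * b)             ≡⟨ +-comm n _ ⟩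
      p + 2 * b + n               ≡⟨ cong (_+ n) (interleave-even n (p + 2 * b)) ⟨
      w (2 * (p + 2 * b)) + n     ∎
      where open ≡-Reasoning

  B C : List ℕ
  B = upTo b
  C = map (b +_) (upTo c)

  ∈B⇒<D : ∀ {j} → j ∈ B → j < D
  ∈B⇒<D j∈ = ≤-trans (∈-upTo⁻ j∈) (m≤m+n b c)

  ∈C⇒<D : ∀ {j} → j ∈ C → j < D
  ∈C⇒<D j∈ = ∈-upTo⁻ (subst (_ ∈_) (upTo-++ b c) (∈-++⁺ʳ B j∈))

  centreLabels : Bool → List (ℕ × ℕ)
  centreLabels true  = centreLabel ∷ []
  centreLabels false = []

  midLabels : List (ℕ × ℕ)
  midLabels = map crossLabel B ++ centreLabels centred

  labelPaths : List (ℕ × ℕ)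
  labelPaths = map pairLabel B ++ midLabels

  labelCycles : List (ℕ × ℕ)
  labelCycles = map pairLabel C

  paths : List Arc
  paths = map relabel labelPaths

  cycles : List (ℕ × ℕ)
  cycles = map relabel labelCycles

  crossLabels-Mid : All Mid (ends (map crossLabel B))
  crossLabels-Mid = ends-map-All B
    (All.map⁺ (All.tabulate λ i∈ → mid-even (<-≤-trans (∈-upTo⁻ i∈) (≤-trans (m≤n*m b 2) room))))
    (All.map⁺ (All.tabulate λ i∈ → mid-odd (1+2i<m (∈-upTo⁻ i∈))))

  midLabels-Mid : All Mid (ends midLabels)
  midLabels-Mid = subst (All Mid) (sym (ends-++ (map crossLabel B) (centreLabels centred)))
    (All.++⁺ crossLabels-Mid (centre centred centre-room))
    where
    centre : ∀ o → (o ≡ true → 2 * b < m) → All Mid (ends (centreLabels o))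
    centre true  2b<m = mid-even (2b<m refl) ∷ mid-odd (2b<m refl) ∷ []
    centre false _    = []

  crossLabels-unique : Unique (ends (map crossLabel B))
  crossLabels-unique = ends-map-unique (Unique.upTo⁺ b)
    (λ {i} {j} _ _ eq → +-cancelˡ-≡ p i j (*-cancelˡ-≡ (p + i) (p + j) 2 eq))
    (λ {i} {j} _ _ eq → *-cancelˡ-≡ i j 2 (suc-injective (+-cancelˡ-≡ p _ _
                          (*-cancelˡ-≡ (p + suc (2 * i)) (p + suc (2 * j)) 2 (suc-injective eq)))))
    (λ {i} {j} _ _ → even≢odd (p + i) (p + suc (2 * j)))

  crossLabels-∌-centre : ∀ {v} → ¬ (v ∈ ends (map crossLabel B) × v ∈ ends (centreLabels true))
  crossLabels-∌-centre (v∈ , v∈centre) with ∈-ends-map⁻ B v∈ | v∈centre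
  ... | i , i∈ , inj₁ refl | here eq = <⇒≢ (<-≤-trans (∈-upTo⁻ i∈) (m≤n*m b 2))
          (+-cancelˡ-≡ p _ _ (*-cancelˡ-≡ (p + i) (p + 2 * b) 2 eq))
  ... | i , i∈ , inj₁ refl | there (here eq) = even≢odd (p + i) (p + 2 * b) eq
  ... | i , i∈ , inj₂ refl | here eq = even≢odd (p + 2 * b) (p + suc (2 * i)) (sym eq)
  ... | i , i∈ , inj₂ refl | there (here eq) = even≢odd b i
          (sym (+-cancelˡ-≡ p _ _ (*-cancelˡ-≡ (p + suc (2 * i)) (p + 2 * b) 2 (suc-injective eq))))

  midLabels-unique : Unique (ends midLabels)
  midLabels-unique = unique centred
    where
    unique : ∀ o → Unique (ends (map crossLabel B ++ centreLabels o))
    unique false = subst Unique (cong ends (sym (++-identityʳ (map crossLabel B)))) crossLabels-unique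
    unique true  = subst Unique (sym (ends-++ (map crossLabel B) _)) (Unique.++⁺ crossLabels-unique
      ((even≢odd (p + 2 * b) (p + 2 * b) ∷ []) ∷ [] ∷ []) crossLabels-∌-centre)

  Outer : ℕ → Set
  Outer ℓ = ℓ < D ⊎ 2 * m + D < ℓ

  Outer⇒¬Mid : ∀ {ℓ} → Outer ℓ → ¬ Mid ℓ
  Outer⇒¬Mid (inj₁ ℓ<D)    (D≤ℓ , _) = <⇒≱ ℓ<D D≤ℓ
  Outer⇒¬Mid (inj₂ 2m+D<ℓ) (_ , ℓ≤)  = <⇒≱ 2m+D<ℓ ℓ≤

  pairLabels-Outer : All Outer (ends (map pairLabel (upTo D)))
  pairLabels-Outer = ends-map-All (upTo D)
    (All.map⁺ (All.tabulate λ j∈ → inj₁ (∈-upTo⁻ j∈)))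
    (All.map⁺ (All.tabulate λ j∈ → inj₂ (2m+D<highLabel (∈-upTo⁻ j∈))))

  pairLabels-< : All (_< t) (ends (map pairLabel (upTo D)))
  pairLabels-< = ends-map-All (upTo D)
    (All.map⁺ (All.tabulate λ j∈ → <-trans (<-≤-trans (∈-upTo⁻ j∈) D≤2m+D) 2m+D<t))
    (All.map⁺ (All.tabulate λ j∈ → highLabel-< (∈-upTo⁻ j∈)))

  pairLabels-unique : Unique (ends (map pairLabel (upTo D)))
  pairLabels-unique = ends-map-unique (Unique.upTo⁺ D) (λ _ _ eq → eq)
    (λ i∈ j∈ → highLabel-injective (∈-upTo⁻ i∈) (∈-upTo⁻ j∈))
    (λ i∈ j∈ → <⇒≢ (<-trans (<-≤-trans (∈-upTo⁻ i∈) D≤2m+D) (2m+D<highLabel (∈-upTo⁻ j∈))))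

  labels-↭ : ends (labelPaths ++ labelCycles) ↭ ends (map pairLabel (upTo D)) ++ ends midLabels
  labels-↭ = begin
    ends ((PB ++ M) ++ PC)
      ≡⟨ cong ends (++-assoc PB M PC) ⟩
    ends (PB ++ (M ++ PC))
      ≡⟨ trans (ends-++ PB _) (cong (ends PB ++_) (ends-++ M PC)) ⟩
    ends PB ++ (ends M ++ ends PC)
      ↭⟨ ++⁺ˡ (ends PB) (++-comm (ends M) (ends PC)) ⟩
    ends PB ++ (ends PC ++ ends M)
      ≡⟨ ++-assoc (ends PB) (ends PC) (ends M) ⟨
    (ends PB ++ ends PC) ++ ends M
      ≡⟨ cong (_++ ends M) (ends-++ PB PC) ⟨
    ends (PB ++ PC) ++ ends M
      ≡⟨ cong (λ l → ends l ++ ends M) (map-++ pairLabel B C) ⟨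
    ends (map pairLabel (B ++ C)) ++ ends M
      ≡⟨ cong (λ l → ends (map pairLabel l) ++ ends M) (upTo-++ b c) ⟩
    ends (map pairLabel (upTo D)) ++ ends M
      ∎
    where
    open PermutationReasoning
    PB PC M : List (ℕ × ℕ)
    PB = map pairLabel B
    PC = map pairLabel C
    M  = midLabels

  labels-unique : Unique (ends (labelPaths ++ labelCycles))
  labels-unique = Unique-resp-↭ (↭-sym labels-↭)
    (++⁺-separated pairLabels-unique midLabels-unique pairLabels-Outer midLabels-Mid Outer⇒¬Mid)

  labels-< : All (_< t) (ends (labelPaths ++ labelCycles))
  labels-< = All-resp-↭ (↭-sym labels-↭) (All.++⁺ pairLabels-< (All.map mid-< midLabels-Mid))

  vertices≡ : vertsOf paths cycles ≡ map w (ends (labelPaths ++ labelCycles))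
  vertices≡ = trans (cong ends (sym (map-++ relabel labelPaths labelCycles)))
                    (ends-relabel w (labelPaths ++ labelCycles))

  vertices-< : All (_< t) (vertsOf paths cycles)
  vertices-< = subst (All (_< t)) (sym vertices≡) (All.map⁺ (All.map (interleave-< n) labels-<))

  vertices-unique : Unique (vertsOf paths cycles)
  vertices-unique = subst Unique (sym vertices≡) (map⁺-injectiveOn
    (λ x∈ y∈ → interleave-injective n (All.lookup labels-< x∈) (All.lookup labels-< y∈)) labels-unique)

  centreDiffs : Bool → List ℕ
  centreDiffs true  = n ∷ []
  centreDiffs false = []

  targetDiffs : Bool → List ℕ
  targetDiffs o = (map low (upTo D) ++ map high (upTo D)) ++ centreDiffs o

  diffs-paths : map (diff t) paths ≡ map low B ++ (map high B ++ centreDiffs centred)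
  diffs-paths = begin
    map (diff t) (map relabel (PB ++ (CR ++ CE)))      ≡⟨ map-∘ (PB ++ (CR ++ CE)) ⟨
    map δ (PB ++ (CR ++ CE))                           ≡⟨ map-++ δ PB _ ⟩
    map δ PB ++ map δ (CR ++ CE)                       ≡⟨ cong (map δ PB ++_) (map-++ δ CR CE) ⟩
    map δ PB ++ (map δ CR ++ map δ CE)                 ≡⟨ cong₂ _++_ pairs (cong₂ _++_ crosses centre) ⟩
    map low B ++ (map high B ++ centreDiffs centred)   ∎
    where
    open ≡-Reasoning
    δ : ℕ × ℕ → ℕ
    δ = diff t ∘ relabel
    PB CR CE : List (ℕ × ℕ)
    PB = map pairLabel B
    CR = map crossLabel B
    CE = centreLabels centred
    pairs : map δ PB ≡ map low B
    pairs = trans (sym (map-∘ B)) (map-cong-local (All.tabulate λ j∈ → diff-pair (∈B⇒<D j∈)))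
    crosses : map δ CR ≡ map high B
    crosses = trans (sym (map-∘ B)) (map-cong-local (All.tabulate λ i∈ → diff-cross (∈-upTo⁻ i∈)))
    centre-cases : ∀ o → (o ≡ true → 2 * b < m) → map δ (centreLabels o) ≡ centreDiffs o
    centre-cases true  2b<m = cong (_∷ []) (diff-centre (2b<m refl))
    centre-cases false _    = refl
    centre : map δ CE ≡ centreDiffs centred
    centre = centre-cases centred centre-room

  diffs-cycles : map (diff t) (arcsOf [] cycles) ≡ ends (map (λ j → low j , high j) C)
  diffs-cycles = trans (map-diff-bothWays t cycles) (cong ends (trans
    (sym (trans (map-∘ C) (map-∘ (map pairLabel C))))
    (map-cong-local (All.tabulate λ j∈ →
      cong₂ _,_ (diff-pair (∈C⇒<D j∈)) (diff-pair-swap (∈C⇒<D j∈))))))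

  diffs-↭ : map (diff t) (arcsOf paths cycles) ↭ targetDiffs centred
  diffs-↭ = begin
    map (diff t) (paths ++ arcsOf [] cycles)
      ≡⟨ map-++ (diff t) paths _ ⟩
    map (diff t) paths ++ map (diff t) (arcsOf [] cycles)
      ≡⟨ cong₂ _++_ diffs-paths diffs-cycles ⟩
    (LB ++ (HB ++ N)) ++ ends (map (λ j → low j , high j) C)
      ↭⟨ ++⁺ˡ (LB ++ (HB ++ N)) (ends-map-↭ low high C) ⟩
    (LB ++ (HB ++ N)) ++ (map low C ++ map high C)
      ↭⟨ ++-interchange LB HB N _ _ ⟩
    ((LB ++ map low C) ++ (HB ++ map high C)) ++ N
      ≡⟨ cong (_++ N) (cong₂ _++_ (map-++ low B C) (map-++ high B C)) ⟨
    (map low (B ++ C) ++ map high (B ++ C)) ++ N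
      ≡⟨ cong (λ l → (map low l ++ map high l) ++ N) (upTo-++ b c) ⟩
    targetDiffs centred
      ∎
    where
    open PermutationReasoning
    LB HB N : List ℕ
    LB = map low B
    HB = map high B
    N  = centreDiffs centred

  targetDiffs-unique : ∀ o → Unique (targetDiffs o)
  targetDiffs-unique o = ++⁺-separated
    (++⁺-separated lows-unique highs-unique lows-<n highs->n <-asym)
    (centre-unique o) lows+highs-≢n (centre-≡n o) (λ d≢n → d≢n)
    where
    lows-<n : All (_< n) (map low (upTo D))
    lows-<n = All.map⁺ (All.tabulate λ {j} _ → s≤s (m∸n≤m (m + D) j))
    highs->n : All (n <_) (map high (upTo D))
    highs->n = All.map⁺ (All.tabulate λ _ → m<m+n n (s≤s z≤n))
    lows+highs-≢n : All (_≢ n) (map low (upTo D) ++ map high (upTo D))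
    lows+highs-≢n = All.++⁺ (All.map <⇒≢ lows-<n) (All.map >⇒≢ highs->n)
    lows-unique : Unique (map low (upTo D))
    lows-unique = map⁺-injectiveOn (λ i∈ j∈ → low-injective (∈-upTo⁻ i∈) (∈-upTo⁻ j∈))
                                   (Unique.upTo⁺ D)
    highs-unique : Unique (map high (upTo D))
    highs-unique = map⁺-injectiveOn (λ _ _ eq → suc-injective (+-cancelˡ-≡ n _ _ eq))
                                    (Unique.upTo⁺ D)
    centre-unique : ∀ o → Unique (centreDiffs o)
    centre-unique true  = [] ∷ []
    centre-unique false = []
    centre-≡n : ∀ o → All (_≡ n) (centreDiffs o)
    centre-≡n true  = refl ∷ []
    centre-≡n false = []

  t/2≡n : t / 2 ≡ n
  t/2≡n = 2*x/2≡x n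

  PMRange⇔ : ∀ {d} → PMRange (suc m) t d ⇔ d ∈ map low (upTo D) ++ map high (upTo D)
  PMRange⇔ {d} = mk⇔ to from
    where
    to : PMRange (suc m) t d → d ∈ map low (upTo D) ++ map high (upTo D)
    to (k , m<k , k≤ , d≡) with subst (λ h → k ≤ h ∸ 1) t/2≡n k≤
    ... | k≤m+D = case d≡
      where
      j = m + D ∸ k
      j<D : j < D
      j<D = +-cancelʳ-≤ m (suc j) D (begin
        suc j + m  ≡⟨ +-suc j m ⟨
        j + suc m  ≤⟨ +-monoʳ-≤ j m<k ⟩
        j + k      ≡⟨ m∸n+n≡m k≤m+D ⟩
        m + D      ≡⟨ +-comm m D ⟩
        D + m      ∎)
        where open ≤-Reasoning
      low-j≡k : low j ≡ k
      low-j≡k = m∸[m∸n]≡n k≤m+D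
      case : d ≡ k ⊎ d ≡ t ∸ k → d ∈ map low (upTo D) ++ map high (upTo D)
      case (inj₁ refl) = ∈-++⁺ˡ (subst (_∈ map low (upTo D)) low-j≡k (∈-map⁺ low (∈-upTo⁺ j<D)))
      case (inj₂ refl) = ∈-++⁺ʳ (map low (upTo D)) (subst (_∈ map high (upTo D))
        (trans (sym (t∸low j<D)) (cong (t ∸_) low-j≡k)) (∈-map⁺ high (∈-upTo⁺ j<D)))
    in-range : ∀ {j} → j < D → suc m ≤ low j × low j ≤ t / 2 ∸ 1
    in-range {j} j<D = m<low j<D , subst (λ h → low j ≤ h ∸ 1) (sym t/2≡n) (m∸n≤m (m + D) j)
    from : d ∈ map low (upTo D) ++ map high (upTo D) → PMRange (suc m) t d
    from d∈ with ∈-++⁻ (map low (upTo D)) d∈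
    ... | inj₁ d∈lows  = let j , j∈ , d≡ = ∈-map⁻ low d∈lows
                             lo , hi = in-range (∈-upTo⁻ j∈)
                         in low j , lo , hi , inj₁ d≡
    ... | inj₂ d∈highs = let j , j∈ , d≡ = ∈-map⁻ high d∈highs
                             lo , hi = in-range (∈-upTo⁻ j∈)
                         in low j , lo , hi , inj₂ (trans d≡ (sym (t∸low (∈-upTo⁻ j∈))))

  InS-even⇔ : ∀ {d} → InS (2 * suc m) t d ⇔ d ∈ targetDiffs false
  InS-even⇔ {d} = mk⇔ to from
    where
    to : InS (2 * suc m) t d → d ∈ targetDiffs false
    to (inj₁ (s-odd , _))   = ⊥-elim (0≢1+n (trans (sym (2*x%2≡0 (suc m))) s-odd))
    to (inj₂ (_ , d∈range)) =
      ∈-++⁺ˡ (Equivalence.to PMRange⇔ (subst (λ x → PMRange x t d) (2*x/2≡x (suc m)) d∈range))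
    from : d ∈ targetDiffs false → InS (2 * suc m) t d
    from d∈ with ∈-++⁻ (map low (upTo D) ++ map high (upTo D)) d∈
    ... | inj₁ d∈± = inj₂ (2*x%2≡0 (suc m) , subst (λ x → PMRange x t d) (sym (2*x/2≡x (suc m)))
                                                      (Equivalence.from PMRange⇔ d∈±))

  InS-odd⇔ : ∀ {d} → InS (suc (2 * m)) t d ⇔ d ∈ targetDiffs true
  InS-odd⇔ {d} = mk⇔ to from
    where
    to : InS (suc (2 * m)) t d → d ∈ targetDiffs true
    to (inj₂ (s-even , _))       = ⊥-elim (0≢1+n (trans (sym s-even) ([1+2*x]%2≡1 m)))
    to (inj₁ (_ , inj₁ d∈range)) =
      ∈-++⁺ˡ (Equivalence.to PMRange⇔ (subst (λ x → PMRange x t d) ([2+2*x]/2≡1+x m) d∈range))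
    to (inj₁ (_ , inj₂ d≡t/2))   =
      ∈-++⁺ʳ (map low (upTo D) ++ map high (upTo D)) (here (trans d≡t/2 t/2≡n))
    from : d ∈ targetDiffs true → InS (suc (2 * m)) t d
    from d∈ with ∈-++⁻ (map low (upTo D) ++ map high (upTo D)) d∈
    ... | inj₁ d∈±        = inj₁ ([1+2*x]%2≡1 m , inj₁ (subst (λ x → PMRange x t d) (sym ([2+2*x]/2≡1+x m))
                                                           (Equivalence.from PMRange⇔ d∈±)))
    ... | inj₂ (here d≡n) = inj₁ ([1+2*x]%2≡1 m , inj₂ (trans d≡n (sym t/2≡n)))

  #paths : length paths ≡ b + (b + length (centreLabels centred))
  #paths = begin
    length (map relabel labelPaths)
      ≡⟨ length-map relabel labelPaths ⟩
    length (map pairLabel B ++ (map crossLabel B ++ CE))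
      ≡⟨ length-++ (map pairLabel B) ⟩
    length (map pairLabel B) + length (map crossLabel B ++ CE)
      ≡⟨ cong (length (map pairLabel B) +_) (length-++ (map crossLabel B)) ⟩
    length (map pairLabel B) + (length (map crossLabel B) + length CE)
      ≡⟨ cong₂ (λ x y → x + (y + length CE)) (#B pairLabel) (#B crossLabel) ⟩
    b + (b + length CE)
      ∎
    where
    open ≡-Reasoning
    CE = centreLabels centred
    #B : (f : ℕ → ℕ × ℕ) → length (map f B) ≡ b
    #B f = trans (length-map f B) (length-upTo b)

  #cycles : length cycles ≡ c
  #cycles = trans (length-map relabel labelCycles)
              (trans (length-map pairLabel C) (trans (length-map (b +_) (upTo c)) (length-upTo c)))

  orthogonal : ∀ {s} → (∀ {d} → InS s t d ⇔ d ∈ targetDiffs centred) →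
               IsOrthogonalPC s t (b + (b + length (centreLabels centred))) c paths cycles
  orthogonal {s} S⇔ = isOrthogonalPC {s = s} paths cycles (targetDiffs centred) #paths #cycles
    vertices-< vertices-unique diffs-↭ (targetDiffs-unique centred) S⇔

≤-ceilHalf : ∀ D → ∃[ p ] D ≤ 2 * p × 2 * p ≤ suc D
≤-ceilHalf D with parity D
... | even q = q , ≤-refl , n≤1+n (2 * q)
... | odd q  = suc q , ≤-trans (n≤1+n _) (≤-reflexive (sym (*-suc 2 q))) , ≤-reflexive (*-suc 2 q)

≤/3⇒*3≤ : ∀ {a s} → a ≤ s / 3 → a * 3 ≤ s
≤/3⇒*3≤ {a} {s} a≤s/3 = ≤-trans (*-monoˡ-≤ 3 a≤s/3) (m/n*n≤m s 3)

even-room : ∀ b m → 2 * b ≤ 2 * suc m / 3 → 2 * b ≤ m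
even-room zero    m _     = z≤n
even-room (suc b) m a≤s/3 = begin
  2 * suc b   ≡⟨ *-suc 2 b ⟩
  2 + 2 * b   ≤⟨ +-monoʳ-≤ 2 (*-monoˡ-≤ b (n≤1+n 2)) ⟩
  2 + 3 * b   ≤⟨ ≤-pred (*-cancelˡ-≤ 2 (subst (_≤ 2 * suc m) (identity b) (≤/3⇒*3≤ a≤s/3))) ⟩
  m           ∎
  where
  open ≤-Reasoning
  identity : ∀ b → 2 * suc b * 3 ≡ 2 * suc (2 + 3 * b)
  identity = solve-∀

odd-room : ∀ b m → suc (2 * b) ≤ suc (2 * m) / 3 → 2 * b < m
odd-room b m a≤s/3 = begin
  suc (2 * b)   ≤⟨ s≤s (*-monoˡ-≤ b (n≤1+n 2)) ⟩
  suc (3 * b)   ≤⟨ *-cancelˡ-≤ 2 (≤-pred (subst (_≤ suc (2 * m)) (identity b) (≤/3⇒*3≤ a≤s/3))) ⟩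
  m             ∎
  where
  open ≤-Reasoning
  identity : ∀ b → suc (2 * b) * 3 ≡ suc (2 * suc (3 * b))
  identity = solve-∀

2*[1+m+D]∸2*[1+m]≡2*D : ∀ m D → 2 * suc (m + D) ∸ 2 * suc m ≡ 2 * D
2*[1+m+D]∸2*[1+m]≡2*D m D =
  trans (sym (*-distribˡ-∸ 2 (suc m + D) (suc m))) (cong (2 *_) (m+n∸m≡n (suc m) D))

2*[1+m+D]∸[1+2*m]≡1+2*D : ∀ m D → 2 * suc (m + D) ∸ suc (2 * m) ≡ suc (2 * D)
2*[1+m+D]∸[1+2*m]≡1+2*D m D =
  trans (cong (_∸ suc (2 * m)) (identity m D)) (m+n∸m≡n (suc (2 * m)) (suc (2 * D)))
  where identity : ∀ m D → 2 * suc (m + D) ≡ suc (2 * m) + suc (2 * D)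
        identity = solve-∀

[2*[b+c]∸2*b]/2≡c : ∀ b c → (2 * (b + c) ∸ 2 * b) / 2 ≡ c
[2*[b+c]∸2*b]/2≡c b c =
  trans (cong (_/ 2) (trans (cong (_∸ 2 * b) (*-distribˡ-+ 2 b c)) (m+n∸m≡n (2 * b) (2 * c))))
        (2*x/2≡x c)

lemma7p2-even : ∀ n s′ b → 2 ≤ 2 * s′ → 2 * s′ < 2 * n → 2 * b ≤ 2 * s′ / 3 →
  2 * b ≤ 2 * n ∸ 2 * s′ →
  ∃[ paths ] ∃[ cycles ]
    IsOrthogonalPC (2 * s′) (2 * n) (2 * b) ((2 * n ∸ 2 * s′ ∸ 2 * b) / 2) paths cycles
lemma7p2-even n (suc m) b _ s<t a≤s/3 a≤t∸s with m≤n⇒∃[o]m+o≡n (<⇒≤ (<-halve {suc m} {n} s<t))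
... | D , refl with m≤n⇒∃[o]m+o≡n
                      (*-cancelˡ-≤ {b} {D} 2 (subst (2 * b ≤_) (2*[1+m+D]∸2*[1+m]≡2*D m D) a≤t∸s))
... | c , refl with ≤-ceilHalf (b + c)
... | p , D≤2p , 2p≤1+D = paths , cycles ,
  subst (λ k → IsOrthogonalPC (2 * suc m) t (2 * b) k paths cycles) (sym #cycles≡c)
    (orthogonal {2 * suc m} InS-even⇔)
  where
  open Construction m b c p D≤2p 2p≤1+D (even-room b m a≤s/3) false (λ ())
  #cycles≡c : (2 * suc (m + (b + c)) ∸ 2 * suc m ∸ 2 * b) / 2 ≡ c
  #cycles≡c = trans (cong (λ x → (x ∸ 2 * b) / 2) (2*[1+m+D]∸2*[1+m]≡2*D m (b + c)))
                    ([2*[b+c]∸2*b]/2≡c b c)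

lemma7p2-odd : ∀ n m b → suc (2 * m) < 2 * n → suc (2 * b) ≤ suc (2 * m) / 3 →
  suc (2 * b) ≤ 2 * n ∸ suc (2 * m) →
  ∃[ paths ] ∃[ cycles ]
    IsOrthogonalPC (suc (2 * m)) (2 * n) (suc (2 * b)) ((2 * n ∸ suc (2 * m) ∸ suc (2 * b)) / 2)
                   paths cycles
lemma7p2-odd n m b s<t a≤s/3 a≤t∸s with m≤n⇒∃[o]m+o≡n (<-halve {m} {n} (<-trans (n<1+n _) s<t))
... | D , refl with m≤n⇒∃[o]m+o≡n (*-cancelˡ-≤ {b} {D} 2
                      (≤-pred (subst (suc (2 * b) ≤_) (2*[1+m+D]∸[1+2*m]≡1+2*D m D) a≤t∸s)))
... | c , refl with ≤-ceilHalf (b + c)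
... | p , D≤2p , 2p≤1+D = paths , cycles ,
  subst₂ (λ a k → IsOrthogonalPC (suc (2 * m)) t a k paths cycles) (identity b) (sym #cycles≡c)
    (orthogonal {suc (2 * m)} InS-odd⇔)
  where
  2b<m = odd-room b m a≤s/3
  open Construction m b c p D≤2p 2p≤1+D (<⇒≤ 2b<m) true (λ _ → 2b<m)
  identity : ∀ b → b + (b + 1) ≡ suc (2 * b)
  identity = solve-∀
  #cycles≡c : (2 * suc (m + (b + c)) ∸ suc (2 * m) ∸ suc (2 * b)) / 2 ≡ c
  #cycles≡c = trans (cong (λ x → (x ∸ suc (2 * b)) / 2) (2*[1+m+D]∸[1+2*m]≡1+2*D m (b + c)))
                    ([2*[b+c]∸2*b]/2≡c b c)

lemma7p2 : (a s t : ℕ) → t % 2 ≡ 0 → 2 ≤ s → s < t → a ≤ s / 3 → a ≤ t ∸ s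
    → a % 2 ≡ s % 2
    → ∃[ paths ] ∃[ cycles ]
        IsOrthogonalPC s t a ((t ∸ s ∸ a) / 2) paths cycles
lemma7p2 a s t t-even 2≤s s<t a≤s/3 a≤t∸s a≡s with parity t | parity s | parity a
... | odd n  | _       | _      = ⊥-elim (1+n≢0 (trans (sym ([1+2*x]%2≡1 n)) t-even))
... | even _ | even s′ | odd b  = ⊥-elim (1+n≢0 (trans (sym ([1+2*x]%2≡1 b)) (trans a≡s (2*x%2≡0 s′))))
... | even _ | odd m   | even b = ⊥-elim (0≢1+n (trans (sym (2*x%2≡0 b)) (trans a≡s ([1+2*x]%2≡1 m))))
... | even n | even s′ | even b = lemma7p2-even n s′ b 2≤s s<t a≤s/3 a≤t∸s
... | even n | odd m   | odd b  = lemma7p2-odd n m b s<t a≤s/3 a≤t∸s
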